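{- In the comparison query model, there is a $2$-competitive algorithm for verifying that a given matching $M$ in a stable matching instance with uncertain preferences on both sides is stable.
   Context: Two disjoint sets $A$, $B$ of agents with $|A|=|B|=n$. Each $a\in A$ has a strict total order $\prec_a$ on $B$ and each $b\in B$ has a strict total order $\prec_b$ on $A$ ($x\prec_y z$: $y$ prefers $x$ to $z$). A matching is a bijection between $A$ and $B$; it is stable if there is no pair $(a,b)$, $b\neq M(a)$, with $a$ preferring $b$ to $M(a)$ and $b$ preferring $a$ to $M(b)$. Two-sided uncertainty: all preference orders of agents in $A$ and in $B$ are initially unknown and are learned only via comparison queries: for an agent $x$ and two agents $y_1,y_2$ of the other side, $\mathit{prefer}(x,y_1,y_2)$ returns whichever of $y_1,y_2$ agent $x$ prefers. An algorithm queries adaptively until the answers prove its output correct (for every preference profile consistent with the answers). It is $\rho$-competitive if its number of queries is at most $\rho$ times the minimum size of a query set whose answers suffice to prove that $M$ is stable; the competitive ratio is measured only on inputs where $M$ is stable, and otherwise the algorithm must detect that $M$ is not stable. -}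

module Defs where

open import Data.Nat using (ℕ; _≤_; _*_)
open import Data.Fin using (Fin; _<_; _<?_)
open import Data.Bool using (Bool; true; false)
open import Data.List using (List; []; _∷_; length)
open import Data.List.Relation.Unary.All using (All)
open import Data.Product using (Σ; _×_; _,_; ∃-syntax)
open import Function.Bundles using (_↔_; Inverse)
open import Function.Definitions using (Injective)
open import Relation.Binary.PropositionalEquality using (_≡_; _≢_)
open import Relation.Nullary using (¬_)
open import Relation.Nullary.Decidable using (⌊_⌋)

-- A strict total order of an agent on the other side (a finite set of size n)
-- is represented by its rank function: an injective (hence bijective) map
-- Fin n → Fin n; y₁ is preferred to y₂ iff rank y₁ < rank y₂.
record Profile (n : ℕ) : Set where
  field
    rankA : Fin n → Fin n → Fin n      -- rankA a b : position of b in a's order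
    rankA-inj : ∀ a → Injective _≡_ _≡_ (rankA a)
    rankB : Fin n → Fin n → Fin n      -- rankB b a : position of a in b's order
    rankB-inj : ∀ b → Injective _≡_ _≡_ (rankB b)
open Profile public

_≺A[_]_ : ∀ {n} → Fin n → (Profile n × Fin n) → Fin n → Set
x ≺A[ (P , a) ] y = rankA P a x < rankA P a y

_≺B[_]_ : ∀ {n} → Fin n → (Profile n × Fin n) → Fin n → Set
x ≺B[ (P , b) ] y = rankB P b x < rankB P b y

-- A matching is a bijection A → B (to = M on A, from = M on B).
Matching : ℕ → Set
Matching n = Fin n ↔ Fin n

Stable : ∀ {n} → Profile n → Matching n → Set
Stable P M = ¬ (∃[ a ] ∃[ b ]
  (b ≢ Inverse.to M a × b ≺A[ (P , a) ] Inverse.to M a × a ≺B[ (P , b) ] Inverse.from M b))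

data Side : Set where
  sideA sideB : Side

record Query (n : ℕ) : Set where
  constructor prefer
  field
    side  : Side
    agent : Fin n
    y₁ y₂ : Fin n

-- Answer: true iff agent x prefers y₁ to y₂ (i.e. prefer returns y₁).
answer : ∀ {n} → Profile n → Query n → Bool
answer P (prefer sideA x y₁ y₂) = ⌊ rankA P x y₁ <? rankA P x y₂ ⌋
answer P (prefer sideB x y₁ y₂) = ⌊ rankB P x y₁ <? rankB P x y₂ ⌋

-- An adaptive deterministic query algorithm (for a fixed instance) is a
-- decision tree: either stop with a verdict (true = "M is stable",
-- false = "M is not stable") or ask a query and branch on its answer.
data Tree (n : ℕ) : Set where
  done : Bool → Tree n
  ask  : Query n → (Bool → Tree n) → Tree n

trace : ∀ {n} → Tree n → Profile n → List (Query n)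
trace (done _)  P = []
trace (ask q k) P = q ∷ trace (k (answer P q)) P

output : ∀ {n} → Tree n → Profile n → Bool
output (done v)  P = v
output (ask q k) P = output (k (answer P q)) P

Agree : ∀ {n} → Profile n → Profile n → List (Query n) → Set
Agree P P' Q = All (λ q → answer P' q ≡ answer P q) Q

Certifies : ∀ {n} → Profile n → Matching n → List (Query n) → Set
Certifies P M Q = ∀ P' → Agree P P' Q → Stable P' M

CorrectRun : ∀ {n} → Matching n → Tree n → Profile n → Set
CorrectRun M T P =
  (output T P ≡ true  → ∀ P' → Agree P P' (trace T P) → Stable P' M) ×
  (output T P ≡ false → ∀ P' → Agree P P' (trace T P) → ¬ Stable P' M)

-- ρ-competitiveness on a stable input: #queries ≤ ρ · (size of any
-- certifying query set), i.e. ≤ ρ · the minimum size of such a set.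
Competitive : ∀ {n} → ℕ → Matching n → Tree n → Profile n → Set
Competitive ρ M T P =
  Stable P M → ∀ (Q : List (Query _)) → Certifies P M Q → length (trace T P) ≤ ρ * length Q

-- The verifier runs through the unmatched pairs (a , b), b ≠ M(a): it asks a whether it prefers
-- b to M(a) and, only if so, asks b whether it prefers a to M(b); two "yes" answers exhibit a
-- blocking pair. Hence it uses at most two queries per unmatched pair.
-- Conversely, a query prefer(x, y₁, y₂) is unaffected by moving anything but its loser to the
-- front of x's list. So if no query of a certificate is a query of a lost by b, or a query of b
-- lost by a, then letting a and b put each other first changes no answer but makes (a , b)
-- blocking. Every certificate therefore needs a separate query for each unmatched pair.
module Submission where

open import Defs
open import Data.Nat using (ℕ)
open import Data.Product using (Σ; _×_)

open import Data.Bool using (Bool; true; false; if_then_else_)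
open import Data.Empty using (⊥-elim)
open import Data.Fin as Fin using (Fin; punchOut; _≟_; _<?_)
open import Data.Fin.Properties using (suc-injective; punchOut-cong′; punchOut-injective; punchOut-mono-≤; punchOut-cancel-≤)
open import Data.List using (List; []; _∷_; length; map; foldr; filter; cartesianProduct; allFin)
open import Data.List.Properties using (length-map; length-removeAt′)
open import Data.List.Membership.Propositional using (_∈_)
open import Data.List.Membership.Propositional.Properties using (∈-map⁺; ∈-filter⁺; ∈-cartesianProduct⁺; ∈-allFin)
import Data.List.Membership.DecPropositional as DecMembership
open import Data.List.Relation.Binary.Subset.Propositional using (_⊆_)
open import Data.List.Relation.Unary.All as All using (All; []; _∷_)
open import Data.List.Relation.Unary.All.Properties using (all-filter)
open import Data.List.Relation.Unary.Any as Any using (Any; here; there; _─_)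
open import Data.List.Relation.Unary.AllPairs using (_∷_)
open import Data.List.Relation.Unary.Unique.Propositional using (Unique)
import Data.List.Relation.Unary.Unique.Propositional.Properties as Unique
open import Data.Nat as ℕ using (zero; suc; _+_; _*_; z≤n; s≤s)
open import Data.Nat.Properties as ℕ using (<⇒≱; ≰⇒>; +-monoʳ-≤; *-suc; *-monoʳ-≤; module ≤-Reasoning)
open import Data.Product using (_,_; proj₁; proj₂; uncurry)
open import Data.Product.Properties using (≡-dec)
open import Data.Sum using (_⊎_; inj₁; inj₂; [_,_]′)
open import Data.Vec.Functional using (updateAt)
open import Data.Vec.Functional.Properties using (updateAt-updates; updateAt-minimal)
open import Function using (_∘_)
open import Function.Bundles using (Inverse)
open import Function.Definitions using (Injective)
open import Relation.Binary.PropositionalEquality using (_≡_; _≢_; refl; sym; trans; cong; subst)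
open import Relation.Nullary using (¬_; Dec; yes; no; ¬?)
open import Relation.Nullary.Decidable using (⌊_⌋; isYes≗does; dec-true; dec-false)

private
  variable
    A : Set
    k m n : ℕ

∈-─⁺ : ∀ {x y} {ys : List A} (x∈ys : x ∈ ys) → y ∈ ys → x ≢ y → y ∈ (ys ─ x∈ys)
∈-─⁺ (here refl)  (here refl)  x≢y = ⊥-elim (x≢y refl)
∈-─⁺ (here refl)  (there y∈ys) _   = y∈ys
∈-─⁺ (there x∈ys) (here refl)  _   = here refl
∈-─⁺ (there x∈ys) (there y∈ys) x≢y = there (∈-─⁺ x∈ys y∈ys x≢y)

Unique-⊆⇒length≤ : {xs ys : List A} → Unique xs → xs ⊆ ys → length xs ℕ.≤ length ys
Unique-⊆⇒length≤ {xs = []} _ _ = z≤n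
Unique-⊆⇒length≤ {xs = x ∷ xs} {ys} (x∉xs ∷ xs!) xs⊆ys = begin
  suc (length xs)          ≤⟨ s≤s (Unique-⊆⇒length≤ xs! xs⊆ys─x) ⟩
  suc (length (ys ─ x∈ys)) ≡⟨ sym (length-removeAt′ ys (Any.index x∈ys)) ⟩
  length ys                ∎
  where
  open ≤-Reasoning
  x∈ys : x ∈ ys
  x∈ys = xs⊆ys (here refl)
  xs⊆ys─x : xs ⊆ (ys ─ x∈ys)
  xs⊆ys─x y∈xs = ∈-─⁺ x∈ys (xs⊆ys (there y∈xs)) (All.lookup x∉xs y∈xs)

punchOut-mono-< : ∀ {i j k : Fin (suc n)} (i≢j : i ≢ j) (i≢k : i ≢ k) →
                  j Fin.< k → punchOut i≢j Fin.< punchOut i≢k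
punchOut-mono-< i≢j i≢k j<k = ≰⇒> (<⇒≱ j<k ∘ punchOut-cancel-≤ i≢k i≢j)

punchOut-cancel-< : ∀ {i j k : Fin (suc n)} (i≢j : i ≢ j) (i≢k : i ≢ k) →
                    punchOut i≢j Fin.< punchOut i≢k → j Fin.< k
punchOut-cancel-< i≢j i≢k pj<pk = ≰⇒> (<⇒≱ pj<pk ∘ punchOut-mono-≤ i≢k i≢j)

module _ {r : Fin k → Fin (suc m)} (r-injective : Injective _≡_ _≡_ r) (b : Fin k) where

  private
    rank-≢ : ∀ {y} → y ≢ b → r b ≢ r y
    rank-≢ y≢b = y≢b ∘ sym ∘ r-injective

  toFront : Fin k → Fin (suc m)
  toFront y with y ≟ b
  ... | yes _   = Fin.zero
  ... | no  y≢b = Fin.suc (punchOut (rank-≢ y≢b))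

  toFront-front : toFront b ≡ Fin.zero
  toFront-front with b ≟ b
  ... | yes _   = refl
  ... | no  b≢b = ⊥-elim (b≢b refl)

  toFront-other : ∀ {y} (y≢b : y ≢ b) → toFront y ≡ Fin.suc (punchOut (rank-≢ y≢b))
  toFront-other {y} y≢b with y ≟ b
  ... | yes y≡b = ⊥-elim (y≢b y≡b)
  ... | no  _   = cong Fin.suc (punchOut-cong′ (r b) refl)

  toFront-first : ∀ {y} → y ≢ b → toFront b Fin.< toFront y
  toFront-first y≢b rewrite toFront-front | toFront-other y≢b = s≤s z≤n

  toFront-mono-< : ∀ {y₁ y₂} → y₂ ≢ b → r y₁ Fin.< r y₂ → toFront y₁ Fin.< toFront y₂
  toFront-mono-< {y₁} {y₂} y₂≢b r₁<r₂ with y₁ ≟ b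
  ... | yes _    = subst (Fin._< toFront y₂) toFront-front (toFront-first y₂≢b)
  ... | no  y₁≢b = subst (Fin.suc (punchOut (rank-≢ y₁≢b)) Fin.<_) (sym (toFront-other y₂≢b))
                     (s≤s (punchOut-mono-< (rank-≢ y₁≢b) (rank-≢ y₂≢b) r₁<r₂))

  toFront-cancel-< : ∀ {y₁ y₂} → y₁ ≢ b → toFront y₁ Fin.< toFront y₂ → r y₁ Fin.< r y₂
  toFront-cancel-< {y₁} {y₂} y₁≢b t₁<t₂ with y₂ ≟ b
  toFront-cancel-< {y₁} {y₂} y₁≢b () | yes _
  ... | no  y₂≢b = punchOut-cancel-< (rank-≢ y₁≢b) (rank-≢ y₂≢b)
      (ℕ.s≤s⁻¹ (subst (Fin._< Fin.suc (punchOut (rank-≢ y₂≢b))) (toFront-other y₁≢b) t₁<t₂))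

  toFront-injective : Injective _≡_ _≡_ toFront
  toFront-injective {x} {y} tx≡ty with x ≟ b | y ≟ b
  toFront-injective {x} {y} tx≡ty | yes x≡b | yes y≡b = trans x≡b (sym y≡b)
  toFront-injective {x} {y} ()    | yes _   | no  _
  toFront-injective {x} {y} ()    | no  _   | yes _
  toFront-injective {x} {y} tx≡ty | no  x≢b | no  y≢b =
    r-injective (punchOut-injective (rank-≢ x≢b) (rank-≢ y≢b) (suc-injective tx≡ty))

  toFront-preserves-comparison : ∀ y₁ y₂ → (if ⌊ r y₁ <? r y₂ ⌋ then y₂ else y₁) ≢ b →
                                 ⌊ toFront y₁ <? toFront y₂ ⌋ ≡ ⌊ r y₁ <? r y₂ ⌋
  toFront-preserves-comparison y₁ y₂ loser≢b with r y₁ <? r y₂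
  ... | yes r₁<r₂ = trans (isYes≗does (toFront y₁ <? toFront y₂))
                      (dec-true (toFront y₁ <? toFront y₂) (toFront-mono-< loser≢b r₁<r₂))
  ... | no  r₁≮r₂ = trans (isYes≗does (toFront y₁ <? toFront y₂))
                      (dec-false (toFront y₁ <? toFront y₂) (r₁≮r₂ ∘ toFront-cancel-< loser≢b))

Ranking : ℕ → Set
Ranking n = Σ (Fin n → Fin n) (Injective _≡_ _≡_)

moveToFront : Fin (suc m) → Ranking (suc m) → Ranking (suc m)
moveToFront b (r , r-injective) = toFront r-injective b , toFront-injective r-injective b

rankingA rankingB : Profile n → Fin n → Ranking n
rankingA P a = rankA P a , rankA-inj P a
rankingB P b = rankB P b , rankB-inj P b

profile : (Fin n → Ranking n) → (Fin n → Ranking n) → Profile n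
profile ρA ρB = record
  { rankA = proj₁ ∘ ρA ; rankA-inj = proj₂ ∘ ρA ; rankB = proj₁ ∘ ρB ; rankB-inj = proj₂ ∘ ρB }

loser : Profile n → Query n → Fin n
loser P q = if answer P q then Query.y₂ q else Query.y₁ q

-- Moving anyone but the loser to the front of the asked agent's list does not change the answer,
-- so this is the only candidate blocking pair a query can speak against.
loserPair : Profile n → Query n → Fin n × Fin n
loserPair P q@(prefer sideA x _ _) = x , loser P q
loserPair P q@(prefer sideB x _ _) = loser P q , x

putFirst : Profile (suc m) → Fin (suc m) → Fin (suc m) → Profile (suc m)
putFirst P a b = profile (updateAt (rankingA P) a (moveToFront b))
                         (updateAt (rankingB P) b (moveToFront a))

module _ (P : Profile (suc m)) (a b : Fin (suc m)) where

  private
    compareBy : Fin (suc m) → Fin (suc m) → Ranking (suc m) → Bool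
    compareBy y₁ y₂ (r , _) = ⌊ r y₁ <? r y₂ ⌋

  putFirst-answer : ∀ q → loserPair P q ≢ (a , b) → answer (putFirst P a b) q ≡ answer P q
  putFirst-answer (prefer sideA x y₁ y₂) ≢ab with x ≟ a
  ... | no  x≢a  = cong (compareBy y₁ y₂) (updateAt-minimal x a (rankingA P) x≢a)
  ... | yes refl = trans (cong (compareBy y₁ y₂) (updateAt-updates a (rankingA P)))
                         (toFront-preserves-comparison (rankA-inj P a) b y₁ y₂ (≢ab ∘ cong (a ,_)))
  putFirst-answer (prefer sideB x y₁ y₂) ≢ab with x ≟ b
  ... | no  x≢b  = cong (compareBy y₁ y₂) (updateAt-minimal x b (rankingB P) x≢b)
  ... | yes refl = trans (cong (compareBy y₁ y₂) (updateAt-updates b (rankingB P)))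
                         (toFront-preserves-comparison (rankB-inj P b) a y₁ y₂ (≢ab ∘ cong (_, b)))

  putFirst-firstA : ∀ {c} → c ≢ b → b ≺A[ (putFirst P a b , a) ] c
  putFirst-firstA c≢b = subst (λ (r , _) → r b Fin.< r _) (sym (updateAt-updates a (rankingA P)))
                              (toFront-first (rankA-inj P a) b c≢b)

  putFirst-firstB : ∀ {c} → c ≢ a → a ≺B[ (putFirst P a b , b) ] c
  putFirst-firstB c≢a = subst (λ (r , _) → r a Fin.< r _) (sym (updateAt-updates b (rankingB P)))
                              (toFront-first (rankB-inj P b) a c≢a)

module _ (M : Matching n) where

  open Inverse M using (to; from)

  Unmatched : Fin n × Fin n → Set
  Unmatched (a , b) = b ≢ to a

  unmatched? : (p : Fin n × Fin n) → Dec (Unmatched p)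
  unmatched? (a , b) = ¬? (b ≟ to a)

  MutuallyTempted : Profile n → Fin n × Fin n → Set
  MutuallyTempted P (a , b) = b ≺A[ (P , a) ] to a × a ≺B[ (P , b) ] from b

  unmatchedPairs : List (Fin n × Fin n)
  unmatchedPairs = filter unmatched? (cartesianProduct (allFin n) (allFin n))

  ∈-unmatchedPairs : ∀ {p} → Unmatched p → p ∈ unmatchedPairs
  ∈-unmatchedPairs {a , b} = ∈-filter⁺ unmatched? (∈-cartesianProduct⁺ (∈-allFin a) (∈-allFin b))

  unmatchedPairs-unmatched : All Unmatched unmatchedPairs
  unmatchedPairs-unmatched = all-filter unmatched? (cartesianProduct (allFin n) (allFin n))

  unmatchedPairs-unique : Unique unmatchedPairs
  unmatchedPairs-unique = Unique.filter⁺ unmatched?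
    (Unique.cartesianProduct⁺ (Unique.allFin⁺ n) (Unique.allFin⁺ n))

  tempted⇒unstable : ∀ {P p} → Unmatched p → MutuallyTempted P p → ¬ Stable P M
  tempted⇒unstable {p = a , b} b≢Ma tempted stable = stable (a , b , b≢Ma , tempted)

  untempted⇒stable : ∀ {P} → All (¬_ ∘ MutuallyTempted P) unmatchedPairs → Stable P M
  untempted⇒stable untempted (a , b , b≢Ma , tempted) =
    All.lookup untempted (∈-unmatchedPairs b≢Ma) tempted

  someTempted⇒unstable : ∀ {P} → Any (MutuallyTempted P) unmatchedPairs → ¬ Stable P M
  someTempted⇒unstable {P} tempted =
    uncurry (tempted⇒unstable {P} {Any.lookup tempted})
            (All.lookupAny unmatchedPairs-unmatched tempted)

certificate-mentions : (M : Matching n) {P : Profile n} {Q : List (Query n)} → Certifies P M Q →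
                       ∀ {p} → Unmatched M p → p ∈ map (loserPair P) Q
certificate-mentions {n = zero} M _ {() , _}
certificate-mentions {n = suc m} M {P} {Q} certifies {a , b} b≢Ma
  with DecMembership._∈?_ (≡-dec _≟_ _≟_) (a , b) (map (loserPair P) Q)
... | yes ab∈ = ab∈
... | no  ab∉ = ⊥-elim (certifies (putFirst P a b) agrees (a , b , b≢Ma , tempted))
  where
  agrees : Agree P (putFirst P a b) Q
  agrees = All.tabulate λ {q} q∈Q →
    putFirst-answer P a b q (λ q↦ab → ab∉ (subst (_∈ _) q↦ab (∈-map⁺ (loserPair P) q∈Q)))
  Mb≢a : Inverse.from M b ≢ a
  Mb≢a Mb≡a = b≢Ma (trans (sym (Inverse.strictlyInverseˡ M b)) (cong (Inverse.to M) Mb≡a))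
  tempted : MutuallyTempted M (putFirst P a b) (a , b)
  tempted = putFirst-firstA P a b (b≢Ma ∘ sym) , putFirst-firstB P a b Mb≢a

certificate-size : (M : Matching n) {P : Profile n} {Q : List (Query n)} → Certifies P M Q →
                   length (unmatchedPairs M) ℕ.≤ length Q
certificate-size M {P} {Q} certifies = begin
  length (unmatchedPairs M)    ≤⟨ Unique-⊆⇒length≤ (unmatchedPairs-unique M) unmatched⊆ ⟩
  length (map (loserPair P) Q) ≡⟨ length-map (loserPair P) Q ⟩
  length Q                     ∎
  where
  open ≤-Reasoning
  unmatched⊆ : unmatchedPairs M ⊆ map (loserPair P) Q
  unmatched⊆ p∈ = certificate-mentions M certifies (All.lookup (unmatchedPairs-unmatched M) p∈)

output-agree : ∀ {P P′ : Profile n} (T : Tree n) → Agree P P′ (trace T P) → output T P′ ≡ output T P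
output-agree (done _)  [] = refl
output-agree {P = P} (ask q k) (same ∷ agrees) rewrite same = output-agree (k (answer P q)) agrees

module _ (M : Matching n) where

  open Inverse M using (to; from)

  checkPair : Fin n × Fin n → Tree n → Tree n
  checkPair (a , b) continue =
    ask (prefer sideA a b (to a)) λ where
      false → continue
      true  → ask (prefer sideB b a (from b)) λ where
        false → continue
        true  → done false

  verify : List (Fin n × Fin n) → Tree n
  verify = foldr checkPair (done true)

  module _ (P : Profile n) where

    checkPair-accepts : ∀ p t → output (checkPair p t) P ≡ true →
                        ¬ MutuallyTempted M P p × output t P ≡ true
    checkPair-accepts (a , b) t accepts with rankA P a b <? rankA P a (to a)
    ... | no  ¬prefersA = ¬prefersA ∘ proj₁ , accepts
    ... | yes _ with rankB P b a <? rankB P b (from b)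
    ...   | no  ¬prefersB = ¬prefersB ∘ proj₂ , accepts
    checkPair-accepts (a , b) t () | yes _ | yes _

    checkPair-rejects : ∀ p t → output (checkPair p t) P ≡ false →
                        MutuallyTempted M P p ⊎ output t P ≡ false
    checkPair-rejects (a , b) t rejects with rankA P a b <? rankA P a (to a)
    ... | no  _ = inj₂ rejects
    ... | yes prefersA with rankB P b a <? rankB P b (from b)
    ...   | no  _        = inj₂ rejects
    ...   | yes prefersB = inj₁ (prefersA , prefersB)

    checkPair-queries : ∀ p t → length (trace (checkPair p t) P) ℕ.≤ 2 + length (trace t P)
    checkPair-queries (a , b) t with rankA P a b <? rankA P a (to a)
    ... | no  _ = ℕ.n≤1+n _
    ... | yes _ with rankB P b a <? rankB P b (from b)
    ...   | no  _ = ℕ.≤-refl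
    ...   | yes _ = s≤s (s≤s z≤n)

    verify-accepts : ∀ ps → output (verify ps) P ≡ true → All (¬_ ∘ MutuallyTempted M P) ps
    verify-accepts []       _       = []
    verify-accepts (p ∷ ps) accepts =
      let untempted , accepts′ = checkPair-accepts p (verify ps) accepts
      in  untempted ∷ verify-accepts ps accepts′

    verify-rejects : ∀ ps → output (verify ps) P ≡ false → Any (MutuallyTempted M P) ps
    verify-rejects []       ()
    verify-rejects (p ∷ ps) rejects =
      [ here , there ∘ verify-rejects ps ]′ (checkPair-rejects p (verify ps) rejects)

    verify-queries : ∀ ps → length (trace (verify ps) P) ℕ.≤ 2 * length ps
    verify-queries []       = z≤n
    verify-queries (p ∷ ps) = begin
      length (trace (checkPair p (verify ps)) P) ≤⟨ checkPair-queries p (verify ps) ⟩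
      2 + length (trace (verify ps) P)           ≤⟨ +-monoʳ-≤ 2 (verify-queries ps) ⟩
      2 + 2 * length ps                          ≡⟨ *-suc 2 (length ps) ⟨
      2 * length (p ∷ ps)                        ∎
      where open ≤-Reasoning

  verifier : Tree n
  verifier = verify (unmatchedPairs M)

verifier-correct : (M : Matching n) (P : Profile n) → CorrectRun M (verifier M) P
verifier-correct M P = accepted , rejected
  where
  accepted : output (verifier M) P ≡ true → ∀ P′ → Agree P P′ (trace (verifier M) P) → Stable P′ M
  accepted accepts P′ agrees = untempted⇒stable M {P′}
    (verify-accepts M P′ (unmatchedPairs M) (trans (output-agree (verifier M) agrees) accepts))
  rejected : output (verifier M) P ≡ false → ∀ P′ → Agree P P′ (trace (verifier M) P) → ¬ Stable P′ M
  rejected rejects P′ agrees = someTempted⇒unstable M {P′}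
    (verify-rejects M P′ (unmatchedPairs M) (trans (output-agree (verifier M) agrees) rejects))

-- The bound holds against every certificate.
verifier-competitive : (M : Matching n) (P : Profile n) → Competitive 2 M (verifier M) P
verifier-competitive M P _ Q certifies = ℕ.≤-trans
  (verify-queries M P (unmatchedPairs M)) (*-monoʳ-≤ 2 (certificate-size M certifies))

theorem13 : Σ (∀ {n} → Matching n → Tree n)
              (λ alg → ∀ (n : ℕ) (M : Matching n) (P : Profile n) →
                CorrectRun M (alg M) P × Competitive 2 M (alg M) P)
theorem13 = verifier , λ _ M P → verifier-correct M P , verifier-competitive M P
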